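{- Let $\Omega$ be a finite set and, for $1\leq k\leq|\Omega|$, let $\mathcal{H}_{k,\Omega}$ be the complete hypergraph on $\Omega$, i.e. the hypergraph whose set of hyperedges is $\mathcal{U}_{k,\Omega}$. Then $\mathcal{F}_1(\mathcal{H}_{k,\Omega})=\mathcal{U}_{|\Omega|-k+1,\Omega}$ and $\mathcal{I}_1(\mathcal{H}_{k,\Omega})=\mathcal{U}_{k,\Omega}$.
   Context: For a finite set $\Omega$, $\mathcal{U}_{k,\Omega}=\{A\subseteq\Omega: |A|=k\}$. A hypergraph $\mathcal{H}$ on $\Omega$ has vertex set $\Omega$ and a clutter of hyperedges (subsets of $\Omega$, none containing another). Two vertex subsets $X,Y$ are adjacent if some hyperedge contains both; a vertex $v$ is adjacent to $X$ if $\{v\}$ and $X$ are adjacent. Vertices are colored black or white. Rule $\mathcal{R}_1$: at each step, a non-empty set $X$ of black vertices contained in a hyperedge $E$, such that no white vertex outside $E$ is adjacent to $X$, forces all white vertices of $E$ to become black; iterating until no change is possible from an initial black set $B$ gives a final black set $\mathcal{R}_1^\ast(B)$ independent of the order of steps. An $\mathcal{R}_1$-forcing set is a non-empty $F\subseteq\Omega$ with $\mathcal{R}_1^\ast(F)=\Omega$; an $\mathcal{R}_1$-immune set is a non-empty $I\subseteq\Omega$ with $\mathcal{R}_1^\ast(\Omega\setminus I)=\Omega\setminus I$. $\mathcal{F}_1(\mathcal{H})$ and $\mathcal{I}_1(\mathcal{H})$ denote the families of inclusion-minimal $\mathcal{R}_1$-forcing sets and inclusion-minimal $\mathcal{R}_1$-immune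 sets. -}

module Defs where

open import Data.Nat using (ℕ)
open import Data.Fin using (Fin)
open import Data.Fin.Subset using (Subset; _∈_; _∉_; _⊆_; _∪_; ∁; ⊤; ∣_∣; Nonempty; ⁅_⁆)
open import Data.Product using (Σ; ∃; _×_)
open import Relation.Nullary using (¬_)
open import Relation.Binary.PropositionalEquality using (_≡_)
open import Relation.Binary.Construct.Closure.ReflexiveTransitive using (Star)

-- The ground set Ω is Fin n; vertex subsets are Subset n.

U : (n k : ℕ) → Subset n → Set
U n k A = ∣ A ∣ ≡ k

-- A hypergraph on Fin n, given by the predicate "is a hyperedge".
-- (The clutter condition is not imposed in general; the only hypergraph used
-- here, the complete one, is a clutter.)
Hypergraph : ℕ → Set₁
Hypergraph n = Subset n → Set

IsEdge : ∀ {n} → Hypergraph n → Subset n → Set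
IsEdge H E = H E

Complete : (n k : ℕ) → Hypergraph n
Complete n k = U n k

Adjacent : ∀ {n} → Hypergraph n → Subset n → Subset n → Set
Adjacent H X Y = ∃ λ E → IsEdge H E × X ⊆ E × Y ⊆ E

VAdjacent : ∀ {n} → Hypergraph n → Fin n → Subset n → Set
VAdjacent H v X = Adjacent H ⁅ v ⁆ X

ValidR1 : ∀ {n} → Hypergraph n → Subset n → Subset n → Subset n → Set
ValidR1 H S X E =
  Nonempty X × X ⊆ S × IsEdge H E × X ⊆ E ×
  (∀ v → v ∉ S → v ∉ E → ¬ VAdjacent H v X)

-- One R1 step: black set S becomes S ∪ E (all white vertices of E turn black).
R1Step : ∀ {n} → Hypergraph n → Subset n → Subset n → Set
R1Step H S S' = ∃ λ X → ∃ λ E → ValidR1 H S X E × S' ≡ S ∪ E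

R1Stable : ∀ {n} → Hypergraph n → Subset n → Set
R1Stable H S = ∀ X E → ValidR1 H S X E → E ⊆ S

-- R1*(B) = T : T is reached from B by iterating R1 steps until no change is
-- possible (the final set is independent of the order of steps).
R1Final : ∀ {n} → Hypergraph n → Subset n → Subset n → Set
R1Final H B T = Star (R1Step H) B T × R1Stable H T

IsR1Forcing : ∀ {n} → Hypergraph n → Subset n → Set
IsR1Forcing H F = Nonempty F × R1Final H F ⊤

IsR1Immune : ∀ {n} → Hypergraph n → Subset n → Set
IsR1Immune H I = Nonempty I × R1Final H (∁ I) (∁ I)

Minimal : ∀ {n} → (Subset n → Set) → Subset n → Set
Minimal P A = P A × (∀ B → P B → B ⊆ A → B ≡ A)

InF1 : ∀ {n} → Hypergraph n → Subset n → Set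
InF1 H = Minimal (IsR1Forcing H)

InI1 : ∀ {n} → Hypergraph n → Subset n → Set
InI1 H = Minimal (IsR1Immune H)

{-# OPTIONS --safe #-}
module Submission where

-- In the complete hypergraph every set of at most k vertices lies in an edge, so
-- a black set S whose white part ∁ S has at least k elements admits no
-- effective step: a step through E that blackens something leaves X ⊂ E, and a
-- white vertex outside E would be adjacent to X. If instead |∁ S| < k, any
-- k-edge covering ∁ S also contains a black vertex, and that single vertex
-- forces all of Ω. Hence F is forcing iff |∁ F| < k and I is immune iff k ≤ |I|;
-- both are thresholds on the cardinality, so the minimal members are exactly
-- the sets of threshold size.

open import Defs
open import Data.Bool.Properties using (not-involutive)
open import Data.Nat using (ℕ; zero; suc; _≤_; _<_; _+_; _∸_; z≤n; s≤s)
open import Data.Nat.Properties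
open import Data.Vec using ([]; _∷_; here)
open import Data.Fin using (Fin)
open import Data.Fin.Properties using (¬∀⟶∃¬)
open import Data.Fin.Subset
  using (Subset; _∈_; _∉_; _⊆_; _∪_; ∁; ⊤; ⊥; ∣_∣; Nonempty; ⁅_⁆; inside; outside)
open import Data.Fin.Subset.Properties
open import Data.Product using (_×_; _,_; ∃; ∃₂)
open import Data.Sum using (inj₁; inj₂)
open import Data.Empty using (⊥-elim)
open import Relation.Nullary using (¬_; yes; no)
open import Relation.Nullary.Negation using (contradiction)
open import Relation.Nullary.Decidable using (_→-dec_)
open import Relation.Binary.PropositionalEquality
  using (_≡_; refl; sym; trans; cong; cong₂; subst)
open import Relation.Binary.Construct.Closure.ReflexiveTransitive using (Star; ε; _◅_)
open import Function.Bundles using (_⇔_; mk⇔; Equivalence)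
open import Function.Construct.Composition using (_⇔-∘_)

open Equivalence using (to; from)

private
  variable
    n : ℕ

∁-involutive : (p : Subset n) → ∁ (∁ p) ≡ p
∁-involutive []      = refl
∁-involutive (s ∷ p) = cong₂ _∷_ (not-involutive s) (∁-involutive p)

∣p∣≡n∸∣∁p∣ : (p : Subset n) → ∣ p ∣ ≡ n ∸ ∣ ∁ p ∣
∣p∣≡n∸∣∁p∣ p = trans (cong ∣_∣ (sym (∁-involutive p))) (∣∁p∣≡n∸∣p∣ (∁ p))

∣p∪q∣≤∣p∣+∣q∣ : (p q : Subset n) → ∣ p ∪ q ∣ ≤ ∣ p ∣ + ∣ q ∣
∣p∪q∣≤∣p∣+∣q∣ []            []            = z≤n
∣p∪q∣≤∣p∣+∣q∣ (inside ∷ p)  (inside ∷ q)  =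
  s≤s (≤-trans (∣p∪q∣≤∣p∣+∣q∣ p q) (+-monoʳ-≤ ∣ p ∣ (n≤1+n ∣ q ∣)))
∣p∪q∣≤∣p∣+∣q∣ (inside ∷ p)  (outside ∷ q) = s≤s (∣p∪q∣≤∣p∣+∣q∣ p q)
∣p∪q∣≤∣p∣+∣q∣ (outside ∷ p) (inside ∷ q)  =
  subst (suc ∣ p ∪ q ∣ ≤_) (sym (+-suc ∣ p ∣ ∣ q ∣)) (s≤s (∣p∪q∣≤∣p∣+∣q∣ p q))
∣p∪q∣≤∣p∣+∣q∣ (outside ∷ p) (outside ∷ q) = ∣p∪q∣≤∣p∣+∣q∣ p q

q⊆p⇒p∪q≡p : {p q : Subset n} → q ⊆ p → p ∪ q ≡ p
q⊆p⇒p∪q≡p {p = p} {q} q⊆p = ⊆-antisym p∪q⊆p (p⊆p∪q q)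
  where
  p∪q⊆p : p ∪ q ⊆ p
  p∪q⊆p x∈p∪q with x∈p∪q⁻ p q x∈p∪q
  ... | inj₁ x∈p = x∈p
  ... | inj₂ x∈q = q⊆p x∈q

∁p⊆q⇒p∪q≡⊤ : {p q : Subset n} → ∁ p ⊆ q → p ∪ q ≡ ⊤
∁p⊆q⇒p∪q≡⊤ {p = p} {q} ∁p⊆q = ⊆-antisym ⊆⊤ ⊤⊆p∪q
  where
  ⊤⊆p∪q : ⊤ ⊆ p ∪ q
  ⊤⊆p∪q {x} _ with x ∈? p
  ... | yes x∈p = p⊆p∪q q x∈p
  ... | no  x∉p = q⊆p∪q p q (∁p⊆q (x∉p⇒x∈∁p x∉p))

x∈p⇒⁅x⁆⊆p : {x : Fin n} {p : Subset n} → x ∈ p → ⁅ x ⁆ ⊆ p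
x∈p⇒⁅x⁆⊆p {x = x} {p} x∈p y∈⁅x⁆ = subst (_∈ p) (sym (x∈⁅y⁆⇒x≡y x y∈⁅x⁆)) x∈p

q⊈p⇒∃∈∖ : {p q : Subset n} → ¬ (q ⊆ p) → ∃ λ x → x ∈ q × x ∉ p
q⊈p⇒∃∈∖ {n} {p} {q} q⊈p
  with ¬∀⟶∃¬ n _ (λ x → x ∈? q →-dec x ∈? p) (λ q⊆p → q⊈p (q⊆p _))
... | x , x∈q↛x∈p with x ∈? q
...   | yes x∈q = x , x∈q , λ x∈p → x∈q↛x∈p (λ _ → x∈p)
...   | no  x∉q = ⊥-elim (x∈q↛x∈p (λ x∈q → contradiction x∈q x∉q))

∣p∣<∣q∣⇒∃∈∖ : {p q : Subset n} → ∣ p ∣ < ∣ q ∣ → ∃ λ x → x ∈ q × x ∉ p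
∣p∣<∣q∣⇒∃∈∖ ∣p∣<∣q∣ = q⊈p⇒∃∈∖ (λ q⊆p → <⇒≱ ∣p∣<∣q∣ (p⊆q⇒∣p∣≤∣q∣ q⊆p))

p⊆q⇒∣q∣≤∣p∣⇒p≡q : {p q : Subset n} → p ⊆ q → ∣ q ∣ ≤ ∣ p ∣ → p ≡ q
p⊆q⇒∣q∣≤∣p∣⇒p≡q {p = p} {q} p⊆q ∣q∣≤∣p∣ with q ⊆? p
... | yes q⊆p = ⊆-antisym p⊆q q⊆p
... | no  q⊈p = contradiction ∣q∣≤∣p∣ (<⇒≱ (p⊂q⇒∣p∣<∣q∣ (p⊆q , q⊈p⇒∃∈∖ q⊈p)))

0<∣p∣⇒Nonempty : {p : Subset n} → 0 < ∣ p ∣ → Nonempty p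
0<∣p∣⇒Nonempty {n} {p} 0<∣p∣ with nonempty? p
... | yes p≢∅ = p≢∅
... | no  p≡∅ = contradiction (trans (cong ∣_∣ (Empty-unique p≡∅)) (∣⊥∣≡0 n)) (>⇒≢ 0<∣p∣)

∃-⊆-between : (p q : Subset n) (m : ℕ) → p ⊆ q → ∣ p ∣ ≤ m → m ≤ ∣ q ∣ →
              ∃ λ r → p ⊆ r × r ⊆ q × ∣ r ∣ ≡ m
∃-⊆-between [] [] zero _ _ _ = [] , (λ ()) , (λ ()) , refl
∃-⊆-between (inside ∷ p) (outside ∷ q) m p⊆q _ _ = contradiction (p⊆q here) λ ()
∃-⊆-between (outside ∷ p) (outside ∷ q) m p⊆q ∣p∣≤m m≤∣q∣
  with ∃-⊆-between p q m (drop-∷-⊆ p⊆q) ∣p∣≤m m≤∣q∣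
... | r , p⊆r , r⊆q , ∣r∣≡m = outside ∷ r , s⊆s p⊆r , s⊆s r⊆q , ∣r∣≡m
∃-⊆-between (inside ∷ p) (inside ∷ q) (suc m) p⊆q (s≤s ∣p∣≤m) (s≤s m≤∣q∣)
  with ∃-⊆-between p q m (drop-∷-⊆ p⊆q) ∣p∣≤m m≤∣q∣
... | r , p⊆r , r⊆q , ∣r∣≡m = inside ∷ r , s⊆s p⊆r , s⊆s r⊆q , cong suc ∣r∣≡m
∃-⊆-between (outside ∷ p) (inside ∷ q) m p⊆q ∣p∣≤m m≤1+∣q∣ with m ≤? ∣ q ∣
... | yes m≤∣q∣ with ∃-⊆-between p q m (drop-∷-⊆ p⊆q) ∣p∣≤m m≤∣q∣
...   | r , p⊆r , r⊆q , ∣r∣≡m = outside ∷ r , s⊆s p⊆r , out⊆ r⊆q , ∣r∣≡m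
∃-⊆-between (outside ∷ p) (inside ∷ q) zero    _   _ _ | no 0≰∣q∣ = contradiction z≤n 0≰∣q∣
∃-⊆-between (outside ∷ p) (inside ∷ q) (suc m) p⊆q _ (s≤s m≤∣q∣) | no m≰∣q∣
  with ∃-⊆-between p q m (drop-∷-⊆ p⊆q) ∣p∣≤m m≤∣q∣
  where ∣p∣≤m = ≤-trans (p⊆q⇒∣p∣≤∣q∣ (drop-∷-⊆ p⊆q)) (≮⇒≥ m≰∣q∣)
...   | r , p⊆r , r⊆q , ∣r∣≡m = inside ∷ r , out⊆ p⊆r , s⊆s r⊆q , cong suc ∣r∣≡m

∣∁p∣<k⇔n∸k+1≤∣p∣ : {k : ℕ} → k ≤ n → (p : Subset n) → ∣ ∁ p ∣ < k ⇔ n ∸ k + 1 ≤ ∣ p ∣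
∣∁p∣<k⇔n∸k+1≤∣p∣ {n} {k} k≤n p rewrite ∣p∣≡n∸∣∁p∣ p | +-comm (n ∸ k) 1 =
  mk⇔ (λ ∣∁p∣<k → ∸-monoʳ-< ∣∁p∣<k k≤n) ∸-cancelʳ-<

minimal-above-threshold⇔∣∣≡ : (P : Subset n → Set) (g : ℕ) →
  (∀ B → P B ⇔ g ≤ ∣ B ∣) → ∀ A → Minimal P A ⇔ ∣ A ∣ ≡ g
minimal-above-threshold⇔∣∣≡ {n} P g P⇔g≤ A = mk⇔ size-of-minimal minimal-of-size
  where
  size-of-minimal : Minimal P A → ∣ A ∣ ≡ g
  size-of-minimal (PA , minimal)
    with ∃-⊆-between ⊥ A g ⊥⊆ (subst (_≤ g) (sym (∣⊥∣≡0 n)) z≤n) (to (P⇔g≤ A) PA)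
  ... | B , _ , B⊆A , ∣B∣≡g =
    subst (λ C → ∣ C ∣ ≡ g) (minimal B (from (P⇔g≤ B) (≤-reflexive (sym ∣B∣≡g))) B⊆A) ∣B∣≡g

  minimal-of-size : ∣ A ∣ ≡ g → Minimal P A
  minimal-of-size ∣A∣≡g =
    from (P⇔g≤ A) (≤-reflexive (sym ∣A∣≡g)) ,
    λ B PB B⊆A → p⊆q⇒∣q∣≤∣p∣⇒p≡q B⊆A (subst (_≤ ∣ B ∣) (sym ∣A∣≡g) (to (P⇔g≤ B) PB))

module _ {H : Hypergraph n} where

  R1Stable-⊤ : R1Stable H ⊤
  R1Stable-⊤ _ _ _ = ⊆⊤

  R1Stable⇒R1Step*-fixed : {S T : Subset n} → R1Stable H S → Star (R1Step H) S T → T ≡ S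
  R1Stable⇒R1Step*-fixed stable ε = refl
  R1Stable⇒R1Step*-fixed {S} stable ((X , E , valid , refl) ◅ steps)
    with S ∪ E | q⊆p⇒p∪q≡p (stable X E valid)
  ... | _ | refl = R1Stable⇒R1Step*-fixed stable steps

module CompleteHypergraph {n k : ℕ} (k≤n : k ≤ n) where

  private
    H : Hypergraph n
    H = Complete n k

  ∣∪∣≤k⇒Adjacent : {X Y : Subset n} → ∣ X ∪ Y ∣ ≤ k → Adjacent H X Y
  ∣∪∣≤k⇒Adjacent {X} {Y} ∣X∪Y∣≤k
    with ∃-⊆-between (X ∪ Y) ⊤ k ⊆⊤ ∣X∪Y∣≤k (subst (k ≤_) (sym (∣⊤∣≡n n)) k≤n)
  ... | E , X∪Y⊆E , _ , ∣E∣≡k =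
    E , ∣E∣≡k , (λ x∈X → X∪Y⊆E (x∈p∪q⁺ (inj₁ x∈X))) , (λ y∈Y → X∪Y⊆E (x∈p∪q⁺ (inj₂ y∈Y)))

  -- A step that blackens some x ∈ E leaves X ⊂ E, so |X| < k and every white v ∉ E
  -- would be adjacent to X through a k-set containing X ∪ ⁅ v ⁆.
  effective-step⇒∁⊆edge : {S X E : Subset n} {x : Fin n} → ValidR1 H S X E →
                           x ∈ E → x ∉ S → ∁ S ⊆ E
  effective-step⇒∁⊆edge {S} {X} {E} {x} (_ , X⊆S , ∣E∣≡k , X⊆E , isolated) x∈E x∉S {v} v∈∁S
    with v ∈? E
  ... | yes v∈E = v∈E
  ... | no  v∉E = contradiction (∣∪∣≤k⇒Adjacent ∣⁅v⁆∪X∣≤k) (isolated v (x∈∁p⇒x∉p v∈∁S) v∉E)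
    where
    ∣X∣<k : ∣ X ∣ < k
    ∣X∣<k = subst (∣ X ∣ <_) ∣E∣≡k (p⊂q⇒∣p∣<∣q∣ (X⊆E , x , x∈E , λ x∈X → x∉S (X⊆S x∈X)))

    ∣⁅v⁆∪X∣≤k : ∣ ⁅ v ⁆ ∪ X ∣ ≤ k
    ∣⁅v⁆∪X∣≤k = ≤-trans (∣p∪q∣≤∣p∣+∣q∣ ⁅ v ⁆ X)
                         (subst (λ c → c + ∣ X ∣ ≤ k) (sym (∣⁅x⁆∣≡1 v)) ∣X∣<k)

  ∁⊆edge⇒∣∁∣<k : {S X E : Subset n} → ValidR1 H S X E → ∁ S ⊆ E → ∣ ∁ S ∣ < k
  ∁⊆edge⇒∣∁∣<k ((x , x∈X) , X⊆S , ∣E∣≡k , X⊆E , _) ∁S⊆E =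
    subst (_ <_) ∣E∣≡k (p⊂q⇒∣p∣<∣q∣ (∁S⊆E , x , X⊆E x∈X , x∈p⇒x∉∁p (X⊆S x∈X)))

  k≤∣∁∣⇒R1Stable : {S : Subset n} → k ≤ ∣ ∁ S ∣ → R1Stable H S
  k≤∣∁∣⇒R1Stable {S} k≤∣∁S∣ X E valid {x} x∈E with x ∈? S
  ... | yes x∈S = x∈S
  ... | no  x∉S =
    contradiction k≤∣∁S∣ (<⇒≱ (∁⊆edge⇒∣∁∣<k valid (effective-step⇒∁⊆edge valid x∈E x∉S)))

  -- Any k-set covering the white vertices contains a black vertex y, and ⁅ y ⁆
  -- forces it: no white vertex lies outside it.
  ∣∁∣<k⇒covering-step : {S : Subset n} → ∣ ∁ S ∣ < k →
                        ∃₂ λ X E → ValidR1 H S X E × ∁ S ⊆ E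
  ∣∁∣<k⇒covering-step {S} ∣∁S∣<k
    with ∃-⊆-between (∁ S) ⊤ k ⊆⊤ (<⇒≤ ∣∁S∣<k) (subst (k ≤_) (sym (∣⊤∣≡n n)) k≤n)
  ... | E , ∁S⊆E , _ , ∣E∣≡k with ∣p∣<∣q∣⇒∃∈∖ (subst (∣ ∁ S ∣ <_) (sym ∣E∣≡k) ∣∁S∣<k)
  ...   | y , y∈E , y∉∁S =
    ⁅ y ⁆ , E ,
    ((y , x∈⁅x⁆ y) , x∈p⇒⁅x⁆⊆p (x∉∁p⇒x∈p y∉∁S) , ∣E∣≡k , x∈p⇒⁅x⁆⊆p y∈E ,
     λ v v∉S v∉E _ → v∉E (∁S⊆E (x∉p⇒x∈∁p v∉S))) ,
    ∁S⊆E

  R1Forcing⇔∣∁∣<k : 1 ≤ k → (F : Subset n) → IsR1Forcing H F ⇔ ∣ ∁ F ∣ < k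
  R1Forcing⇔∣∁∣<k 1≤k F = mk⇔ forcing⇒ forcing⇐
    where
    forcing⇒ : IsR1Forcing H F → ∣ ∁ F ∣ < k
    forcing⇒ (_ , steps , _) with k ≤? ∣ ∁ F ∣
    ... | no  k≰∣∁F∣ = ≰⇒> k≰∣∁F∣
    ... | yes k≤∣∁F∣ with 0<∣p∣⇒Nonempty (≤-trans 1≤k k≤∣∁F∣)
    ...   | y , y∈∁F = contradiction
      (subst (y ∈_) (R1Stable⇒R1Step*-fixed (k≤∣∁∣⇒R1Stable k≤∣∁F∣) steps) ∈⊤)
      (x∈∁p⇒x∉p y∈∁F)

    forcing⇐ : ∣ ∁ F ∣ < k → IsR1Forcing H F
    forcing⇐ ∣∁F∣<k with ∣∁∣<k⇒covering-step ∣∁F∣<k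
    ... | X , E , valid , ∁F⊆E =
      0<∣p∣⇒Nonempty (subst (0 <_) (sym (∣p∣≡n∸∣∁p∣ F)) (m<n⇒0<n∸m (<-≤-trans ∣∁F∣<k k≤n))) ,
      (X , E , valid , sym (∁p⊆q⇒p∪q≡⊤ ∁F⊆E)) ◅ ε ,
      R1Stable-⊤

  R1Immune⇔k≤∣∣ : 1 ≤ k → (I : Subset n) → IsR1Immune H I ⇔ k ≤ ∣ I ∣
  R1Immune⇔k≤∣∣ 1≤k I = mk⇔ immune⇒ immune⇐
    where
    ∣∁∁I∣≡∣I∣ : ∣ ∁ (∁ I) ∣ ≡ ∣ I ∣
    ∣∁∁I∣≡∣I∣ = cong ∣_∣ (∁-involutive I)

    immune⇒ : IsR1Immune H I → k ≤ ∣ I ∣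
    immune⇒ ((y , y∈I) , _ , stable) with k ≤? ∣ I ∣
    ... | yes k≤∣I∣ = k≤∣I∣
    ... | no  k≰∣I∣ with ∣∁∣<k⇒covering-step (subst (_< k) (sym ∣∁∁I∣≡∣I∣) (≰⇒> k≰∣I∣))
    ...   | X , E , valid , ∁∁I⊆E =
      contradiction y∈I (x∈∁p⇒x∉p (stable X E valid (∁∁I⊆E (x∉p⇒x∈∁p (x∈p⇒x∉∁p y∈I)))))

    immune⇐ : k ≤ ∣ I ∣ → IsR1Immune H I
    immune⇐ k≤∣I∣ =
      0<∣p∣⇒Nonempty (≤-trans 1≤k k≤∣I∣) ,
      ε ,
      k≤∣∁∣⇒R1Stable (subst (k ≤_) (sym ∣∁∁I∣≡∣I∣) k≤∣I∣)

proposition9 : (n k : ℕ) → 1 ≤ k → k ≤ n →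
    (∀ (A : Subset n) → InF1 (Complete n k) A ⇔ U n (n ∸ k + 1) A) ×
    (∀ (A : Subset n) → InI1 (Complete n k) A ⇔ U n k A)
proposition9 n k 1≤k k≤n =
  minimal-above-threshold⇔∣∣≡ _ (n ∸ k + 1)
    (λ F → ∣∁p∣<k⇔n∸k+1≤∣p∣ k≤n F ⇔-∘ R1Forcing⇔∣∁∣<k 1≤k F) ,
  minimal-above-threshold⇔∣∣≡ _ k (R1Immune⇔k≤∣∣ 1≤k)
  where open CompleteHypergraph k≤n
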